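{- Let $p$ be a prime, $n\ge 2$ an integer, $H=\langle h\rangle$ and $P=\langle g\rangle$ cyclic groups of orders $n+2$ and $p$, $G=H\times P$, and let $\gamma_1,\gamma_2$ be integers. Let $R\subseteq G$ be an $$\left(n+2,\,p,\,n,\,\tfrac{n-\gamma_2-2}{p}+\gamma_2,\,0,\,\tfrac{n-\gamma_1-1}{p}+\gamma_1,\,\tfrac{n-\gamma_2-2}{p},\,\tfrac{n-\gamma_1-1}{p}\right)$$ PDPDS in $G$ relative to $H$ and $P$. For $i=0,1,\ldots,p-1$ let $s_i$ be the number of elements of $R$ of the form $h^ag^i$ ($a\in\mathbb{Z}$). Then $$\sum_{j=0}^{p-1}s_j^2=\Big(\tfrac{n-\gamma_2-2}{p}+\gamma_2\Big)(n-1)+2\Big(\tfrac{n-\gamma_1-1}{p}+\gamma_1\Big)+n$$ and $$\sum_{j=0}^{p-1}s_js_{j-i}=\Big(\tfrac{n-\gamma_2-2}{p}\Big)(n-1)+2\Big(\tfrac{n-\gamma_1-1}{p}\Big)$$ for each $i=1,2,\ldots,\lceil\frac{p-1}{2}\rceil$, where subscripts are taken modulo $p$.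
   Context: With $H=\langle h\rangle$ cyclic of order $n+2$, $P=\langle g\rangle$ cyclic of order $p$ and $G=H\times P$, a subset $R\subseteq G$ with $|R|=k$ is an $(n+2,p,k,\lambda_1,\lambda_2,\lambda_3,\mu_1,\mu_2)$ partial direct product difference set (PDPDS) in $G$ relative to $H$ and $P$ if the quotients $r_1r_2^{ -1}$, $r_1,r_2\in R$, $r_1\ne r_2$, represent: each of $h^2,\ldots,h^n$ exactly $\lambda_1$ times; each non-identity element of $P$ exactly $\lambda_2$ times; each of $h,h^{n+1}$ exactly $\lambda_3$ times; each $h^ag^b$ with $2\le a\le n$, $1\le b\le p-1$ exactly $\mu_1$ times; each $h^ag^b$ with $a\in\{1,n+1\}$, $1\le b\le p-1$ exactly $\mu_2$ times (parameters are nonnegative integers). -}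

module Defs where

open import Data.Nat using (ℕ; zero; suc; _+_; _*_; _∸_; _≤ᵇ_; _≡ᵇ_; _≤_)
open import Data.Bool using (Bool; true; false; if_then_else_; not; _∧_)
open import Data.Fin using (Fin; toℕ)
open import Data.Product using (_×_; _,_; proj₁; proj₂)
open import Data.List using (List; []; _∷_; length; map; upTo; cartesianProduct)
open import Data.Nat.ListAction using (sum)
open import Data.List.Relation.Unary.Unique.Propositional using (Unique)
open import Relation.Binary.PropositionalEquality using (_≡_)

-- Elements of G = H × P with H = ⟨h⟩ of order m = n+2, P = ⟨g⟩ of order p:
-- the element h^a g^b is encoded by its exponent pair (a , b) ∈ Fin m × Fin p.
Elt : ℕ → ℕ → Set
Elt m p = Fin m × Fin p

-- (a - b) mod m, for a b < m (no division needed).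
subMod : ℕ → ℕ → ℕ → ℕ
subMod m a b = if b ≤ᵇ a then a ∸ b else (a + m) ∸ b

quot : {m p : ℕ} → Elt m p → Elt m p → ℕ × ℕ
quot {m} {p} (a₁ , b₁) (a₂ , b₂) =
  subMod m (toℕ a₁) (toℕ a₂) , subMod p (toℕ b₁) (toℕ b₂)

eltEq : {m p : ℕ} → Elt m p → Elt m p → Bool
eltEq (a₁ , b₁) (a₂ , b₂) = (toℕ a₁ ≡ᵇ toℕ a₂) ∧ (toℕ b₁ ≡ᵇ toℕ b₂)

countB : {A : Set} → (A → Bool) → List A → ℕ
countB f [] = 0
countB f (x ∷ xs) = if f x then suc (countB f xs) else countB f xs

reps : {m p : ℕ} → List (Elt m p) → ℕ → ℕ → ℕ
reps R a b = countB
  (λ rr → not (eltEq (proj₁ rr) (proj₂ rr))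
          ∧ (proj₁ (quot (proj₁ rr) (proj₂ rr)) ≡ᵇ a)
          ∧ (proj₂ (quot (proj₁ rr) (proj₂ rr)) ≡ᵇ b))
  (cartesianProduct R R)

record IsPDPDS (n p : ℕ) (R : List (Elt (suc (suc n)) p))
               (k λ₁ λ₂ λ₃ μ₁ μ₂ : ℕ) : Set where
  field
    unique : Unique R
    size   : length R ≡ k
    repλ₁  : ∀ a → 2 ≤ a → a ≤ n → reps R a 0 ≡ λ₁
    repλ₂  : ∀ b → 1 ≤ b → b ≤ p ∸ 1 → reps R 0 b ≡ λ₂
    repλ₃₁ : reps R 1 0 ≡ λ₃
    repλ₃₂ : reps R (suc n) 0 ≡ λ₃
    repμ₁  : ∀ a b → 2 ≤ a → a ≤ n → 1 ≤ b → b ≤ p ∸ 1 → reps R a b ≡ μ₁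
    repμ₂₁ : ∀ b → 1 ≤ b → b ≤ p ∸ 1 → reps R 1 b ≡ μ₂
    repμ₂₂ : ∀ b → 1 ≤ b → b ≤ p ∸ 1 → reps R (suc n) b ≡ μ₂

sCount : {m p : ℕ} → List (Elt m p) → ℕ → ℕ
sCount R i = countB (λ r → toℕ (proj₂ r) ≡ᵇ i) R

sumTo : ℕ → (ℕ → ℕ) → ℕ
sumTo p f = sum (map f (upTo p))

-- Both sides count ordered pairs (r₁ , r₂) ∈ R × R: Σⱼ sⱼ s_{j-i} is the number of pairs
-- whose P-components differ by gⁱ.  For i = 0 the diagonal pairs contribute |R| = n; the
-- remaining pairs are sorted by their H-difference hᵃ, and for each a the PDPDS parameters
-- say how many there are: 0 for a = 0, λ₃ (resp. μ₂) for a ∈ {1, n+1} and λ₁ (resp. μ₁) for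
-- the n - 1 values 2 ≤ a ≤ n.
module Submission where

open import Defs
open import Data.Bool using (Bool; true; false; if_then_else_; not; _∧_; T)
open import Data.Bool.Properties using (∧-assoc; ∧-comm; ∧-identityʳ; ∧-zeroʳ; T-≡; T-∧; ⇔→≡)
open import Data.Empty using (⊥-elim)
open import Data.Fin using (toℕ)
open import Data.Fin.Properties using (toℕ<n; toℕ-injective)
open import Data.Integer using (ℤ; +_) renaming (_+_ to _+ℤ_; _*_ to _*ℤ_; _-_ to _-ℤ_)
open import Data.List using (List; []; _∷_; [_]; _++_; length; map; upTo; applyUpTo; cartesianProduct)
open import Data.List.Membership.Propositional using (_∈_)
open import Data.List.Membership.Propositional.Properties using (∈-upTo⁺)
open import Data.List.Properties using (map-cong; map-cong-local; map-∘; map-++; map-upTo; applyUpTo-∷ʳ)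
open import Data.List.Relation.Unary.All as All using (All; []; _∷_)
open import Data.List.Relation.Unary.Any using (here; there)
open import Data.List.Relation.Unary.Unique.Propositional using (Unique; []; _∷_)
open import Data.List.Relation.Unary.Unique.Propositional.Properties using (upTo⁺)
open import Data.Nat using (ℕ; zero; suc; _+_; _*_; _∸_; _≤_; _<_; _≡ᵇ_; _≤ᵇ_; z≤n; s≤s; ⌈_/2⌉)
open import Data.Nat.ListAction using (sum)
open import Data.Nat.ListAction.Properties using (sum-++)
open import Data.Nat.Primality using (Prime; ¬prime[0])
open import Data.Nat.Properties
open import Data.Nat.Tactic.RingSolver using (solve-∀)
open import Data.Product using (_×_; _,_; proj₁; proj₂)
open import Function using (_∘_; const; mk⇔; Equivalence)
open import Relation.Binary.PropositionalEquality
  using (_≡_; _≢_; refl; sym; trans; cong; cong₂; subst; module ≡-Reasoning)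
open import Relation.Nullary using (yes; no)

private
  variable
    A B : Set

iverson : Bool → ℕ
iverson b = if b then 1 else 0

iverson-∧ : ∀ u v → iverson (u ∧ v) ≡ iverson u * iverson v
iverson-∧ true  v = sym (+-identityʳ (iverson v))
iverson-∧ false v = refl

≡ᵇ-cong : ∀ {x y u v} → (x ≡ y → u ≡ v) → (u ≡ v → x ≡ y) → (x ≡ᵇ y) ≡ (u ≡ᵇ v)
≡ᵇ-cong {x} {y} {u} {v} to from = ⇔→≡ {z = true} (mk⇔
  (λ e → Equivalence.to T-≡ (≡⇒≡ᵇ u v (to (≡ᵇ⇒≡ x y (Equivalence.from T-≡ e)))))
  (λ e → Equivalence.to T-≡ (≡⇒≡ᵇ x y (from (≡ᵇ⇒≡ u v (Equivalence.from T-≡ e))))))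

countB≡sum-iverson : ∀ (f : A → Bool) xs → countB f xs ≡ sum (map (iverson ∘ f) xs)
countB≡sum-iverson f []       = refl
countB≡sum-iverson f (x ∷ xs) with f x
... | true  = cong suc (countB≡sum-iverson f xs)
... | false = countB≡sum-iverson f xs

countB-cong : {f g : A → Bool} → (∀ x → f x ≡ g x) → ∀ xs → countB f xs ≡ countB g xs
countB-cong f≗g []       = refl
countB-cong f≗g (x ∷ xs) rewrite f≗g x = cong (λ c → if _ then suc c else c) (countB-cong f≗g xs)

countB-false : {f : A → Bool} → (∀ x → f x ≡ false) → ∀ xs → countB f xs ≡ 0
countB-false f≡false []       = refl
countB-false f≡false (x ∷ xs) rewrite f≡false x = countB-false f≡false xs

countB-split : ∀ (g f : A → Bool) xs →
  countB f xs ≡ countB (λ x → g x ∧ f x) xs + countB (λ x → not (g x) ∧ f x) xs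
countB-split g f []       = refl
countB-split g f (x ∷ xs) with g x | f x
... | true  | true  = cong suc (countB-split g f xs)
... | true  | false = countB-split g f xs
... | false | true  = trans (cong suc (countB-split g f xs)) (sym (+-suc _ _))
... | false | false = countB-split g f xs

sum-map-cong : {f g : A → ℕ} → (∀ x → f x ≡ g x) → ∀ xs → sum (map f xs) ≡ sum (map g xs)
sum-map-cong f≗g xs = cong sum (map-cong f≗g xs)

sum-map-cong-∈ : {f g : A → ℕ} → ∀ xs → (∀ x → x ∈ xs → f x ≡ g x) → sum (map f xs) ≡ sum (map g xs)
sum-map-cong-∈ xs f≗g = cong sum (map-cong-local (All.tabulate (λ {x} → f≗g x)))

sum-map-+ : ∀ (f g : A → ℕ) xs → sum (map (λ x → f x + g x) xs) ≡ sum (map f xs) + sum (map g xs)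
sum-map-+ f g []       = refl
sum-map-+ f g (x ∷ xs) rewrite sum-map-+ f g xs = +-+-comm (f x) (g x) _ _
  where +-+-comm : ∀ a b c d → a + b + (c + d) ≡ a + c + (b + d)
        +-+-comm = solve-∀

sum-map-*ˡ : ∀ c (f : A → ℕ) xs → c * sum (map f xs) ≡ sum (map (λ x → c * f x) xs)
sum-map-*ˡ c f []       = *-zeroʳ c
sum-map-*ˡ c f (x ∷ xs) = trans (*-distribˡ-+ c (f x) _) (cong (_+_ (c * f x)) (sum-map-*ˡ c f xs))

sum-map-*ʳ : ∀ c (f : A → ℕ) xs → sum (map f xs) * c ≡ sum (map (λ x → f x * c) xs)
sum-map-*ʳ c f []       = refl
sum-map-*ʳ c f (x ∷ xs) = trans (*-distribʳ-+ c (f x) _) (cong (_+_ (f x * c)) (sum-map-*ʳ c f xs))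

sum-map-cartesianProduct : ∀ (w : A × B → ℕ) xs ys →
  sum (map w (cartesianProduct xs ys)) ≡ sum (map (λ x → sum (map (λ y → w (x , y)) ys)) xs)
sum-map-cartesianProduct w []       ys = refl
sum-map-cartesianProduct w (x ∷ xs) ys = begin
  sum (map w (map (x ,_) ys ++ cartesianProduct xs ys))
    ≡⟨ cong sum (map-++ w (map (x ,_) ys) _) ⟩
  sum (map w (map (x ,_) ys) ++ map w (cartesianProduct xs ys))
    ≡⟨ sum-++ (map w (map (x ,_) ys)) _ ⟩
  sum (map w (map (x ,_) ys)) + sum (map w (cartesianProduct xs ys))
    ≡⟨ cong₂ _+_ (cong sum (sym (map-∘ ys))) (sum-map-cartesianProduct w xs ys) ⟩
  sum (map (λ y → w (x , y)) ys) + sum (map (λ x → sum (map (λ y → w (x , y)) ys)) xs) ∎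
  where open ≡-Reasoning

sum-*-sum : ∀ (f : A → ℕ) (g : B → ℕ) xs ys →
  sum (map f xs) * sum (map g ys) ≡ sum (map (λ (x , y) → f x * g y) (cartesianProduct xs ys))
sum-*-sum f g xs ys = begin
  sum (map f xs) * sum (map g ys)                        ≡⟨ sum-map-*ʳ _ f xs ⟩
  sum (map (λ x → f x * sum (map g ys)) xs)              ≡⟨ sum-map-cong (λ x → sum-map-*ˡ (f x) g ys) xs ⟩
  sum (map (λ x → sum (map (λ y → f x * g y) ys)) xs)    ≡⟨ sum-map-cartesianProduct _ xs ys ⟨
  sum (map (λ (x , y) → f x * g y) (cartesianProduct xs ys)) ∎
  where open ≡-Reasoning

sum-map-comm : ∀ (w : A → B → ℕ) xs ys →
  sum (map (λ x → sum (map (w x) ys)) xs) ≡ sum (map (λ y → sum (map (λ x → w x y) xs)) ys)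
sum-map-comm w []       ys = sym (sum-map-0 ys)
  where sum-map-0 : ∀ (ys : List B) → sum (map (const 0) ys) ≡ 0
        sum-map-0 []       = refl
        sum-map-0 (y ∷ ys) = sum-map-0 ys
sum-map-comm w (x ∷ xs) ys =
  trans (cong (_+_ (sum (map (w x) ys))) (sum-map-comm w xs ys)) (sym (sum-map-+ (w x) _ ys))

sum-map-1 : ∀ (xs : List A) → sum (map (const 1) xs) ≡ length xs
sum-map-1 []       = refl
sum-map-1 (x ∷ xs) = cong suc (sum-map-1 xs)

sum-sift : (eq : A → A → Bool) → (∀ x → T (eq x x)) → (∀ x y → T (eq x y) → x ≡ y) →
  ∀ (c : A → ℕ) {x xs} → Unique xs → x ∈ xs → sum (map (λ y → iverson (eq x y) * c y) xs) ≡ c x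
sum-sift {A = A} eq eq-refl eq-sound c {x} = sift
  where
  term : A → ℕ
  term y = iverson (eq x y) * c y

  term-≢ : ∀ {y} → x ≢ y → term y ≡ 0
  term-≢ {y} x≢y with eq x y in e
  ... | false = refl
  ... | true  = ⊥-elim (x≢y (eq-sound x y (subst T (sym e) _)))

  term-self : term x ≡ c x
  term-self with eq x x | eq-refl x
  ... | true | _ = +-identityʳ (c x)

  sum-≢ : ∀ {ys} → All (x ≢_) ys → sum (map term ys) ≡ 0
  sum-≢ []            = refl
  sum-≢ (x≢y ∷ x∉ys) = cong₂ _+_ (term-≢ x≢y) (sum-≢ x∉ys)

  sift : ∀ {xs} → Unique xs → x ∈ xs → sum (map term xs) ≡ c x
  sift (x∉ys ∷ _) (here refl) =
    trans (cong₂ _+_ term-self (sum-≢ x∉ys)) (+-identityʳ (c x))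
  sift (y∉ys ∷ u) (there x∈ys) =
    cong₂ _+_ (term-≢ (λ x≡y → All.lookup y∉ys x∈ys (sym x≡y))) (sift u x∈ys)

sum-sift-ℕ : ∀ (c : ℕ → ℕ) {k n} → k < n → sum (map (λ j → iverson (k ≡ᵇ j) * c j) (upTo n)) ≡ c k
sum-sift-ℕ c {k} {n} k<n = sum-sift _≡ᵇ_ (λ x → ≡⇒≡ᵇ x x refl) ≡ᵇ⇒≡ c (upTo⁺ n) (∈-upTo⁺ k<n)

sumTo-countB-fibres : ∀ m (key : A → ℕ) (f : A → Bool) xs → (∀ x → key x < m) →
  sumTo m (λ a → countB (λ x → (key x ≡ᵇ a) ∧ f x) xs) ≡ countB f xs
sumTo-countB-fibres m key f xs key<m = begin
  sumTo m (λ a → countB (λ x → (key x ≡ᵇ a) ∧ f x) xs)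
    ≡⟨ sum-map-cong (λ a → countB≡sum-iverson _ xs) (upTo m) ⟩
  sum (map (λ a → sum (map (λ x → iverson ((key x ≡ᵇ a) ∧ f x)) xs)) (upTo m))
    ≡⟨ sum-map-comm _ (upTo m) xs ⟩
  sum (map (λ x → sum (map (λ a → iverson ((key x ≡ᵇ a) ∧ f x)) (upTo m))) xs)
    ≡⟨ sum-map-cong fibre xs ⟩
  sum (map (iverson ∘ f) xs)
    ≡⟨ countB≡sum-iverson f xs ⟨
  countB f xs ∎
  where
  open ≡-Reasoning
  fibre : ∀ x → sum (map (λ a → iverson ((key x ≡ᵇ a) ∧ f x)) (upTo m)) ≡ iverson (f x)
  fibre x = trans (sum-map-cong (λ a → iverson-∧ (key x ≡ᵇ a) (f x)) (upTo m))
                  (sum-sift-ℕ (const (iverson (f x))) (key<m x))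

sum-applyUpTo-const : ∀ (f : ℕ → ℕ) c n → (∀ a → a < n → f a ≡ c) → sum (applyUpTo f n) ≡ n * c
sum-applyUpTo-const f c zero    _     = refl
sum-applyUpTo-const f c (suc n) f≡c =
  cong₂ _+_ (f≡c 0 (s≤s z≤n)) (sum-applyUpTo-const (f ∘ suc) c n (λ a a<n → f≡c (suc a) (s≤s a<n)))

sumTo-constant-interior : ∀ (f : ℕ → ℕ) k c → (∀ a → 2 ≤ a → a ≤ suc k → f a ≡ c) →
  sumTo (3 + k) f ≡ f 0 + (f 1 + (k * c + f (2 + k)))
sumTo-constant-interior f k c f≡c = begin
  sumTo (3 + k) f                                       ≡⟨ cong sum (map-upTo f (3 + k)) ⟩
  f 0 + (f 1 + sum (applyUpTo interior (suc k)))        ≡⟨ cong (λ l → f 0 + (f 1 + sum l)) (applyUpTo-∷ʳ interior k) ⟨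
  f 0 + (f 1 + sum (applyUpTo interior k ++ [ f (2 + k) ]))
    ≡⟨ cong (λ s → f 0 + (f 1 + s)) (sum-++ (applyUpTo interior k) _) ⟩
  f 0 + (f 1 + (sum (applyUpTo interior k) + (f (2 + k) + 0)))
    ≡⟨ cong₂ (λ s t → f 0 + (f 1 + (s + t)))
         (sum-applyUpTo-const interior c k (λ a a<k → f≡c (2 + a) (s≤s (s≤s z≤n)) (s≤s a<k)))
         (+-identityʳ (f (2 + k))) ⟩
  f 0 + (f 1 + (k * c + f (2 + k))) ∎
  where
  open ≡-Reasoning
  interior : ℕ → ℕ
  interior a = f (2 + a)

subMod-≤ : ∀ m {a b} → b ≤ a → subMod m a b ≡ a ∸ b
subMod-≤ m {a} {b} b≤a with b ≤ᵇ a | ≤⇒≤ᵇ b≤a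
... | true | _ = refl

subMod-> : ∀ m {a b} → a < b → subMod m a b ≡ a + m ∸ b
subMod-> m {a} {b} a<b with b ≤ᵇ a in e
... | false = refl
... | true  = ⊥-elim (<⇒≱ a<b (≤ᵇ⇒≤ b a (subst T (sym e) _)))

subMod-self : ∀ m a → subMod m a a ≡ 0
subMod-self m a = trans (subMod-≤ m {a} ≤-refl) (n∸n≡0 a)

subMod-< : ∀ m {a b} → a < m → b < m → subMod m a b < m
subMod-< m {a} {b} a<m b<m with b ≤? a
... | yes b≤a = subst (_< m) (sym (subMod-≤ m b≤a)) (≤-<-trans (m∸n≤m a b) a<m)
... | no  b≰a = subst (_< m) (sym (subMod-> m (≰⇒> b≰a)))
  (subst (a + m ∸ b <_) (m+n∸m≡n a m) (∸-monoʳ-< (≰⇒> b≰a) (≤-trans (<⇒≤ b<m) (m≤n+m m a))))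

subMod-subMod : ∀ m {a b} → b < m → subMod m a (subMod m a b) ≡ b
subMod-subMod m {a} {b} b<m with b ≤? a
... | yes b≤a = begin
  subMod m a (subMod m a b) ≡⟨ cong (subMod m a) (subMod-≤ m b≤a) ⟩
  subMod m a (a ∸ b)        ≡⟨ subMod-≤ m (m∸n≤m a b) ⟩
  a ∸ (a ∸ b)               ≡⟨ m∸[m∸n]≡n b≤a ⟩
  b                         ∎
  where open ≡-Reasoning
... | no  b≰a = begin
  subMod m a (subMod m a b) ≡⟨ cong (subMod m a) (subMod-> m (≰⇒> b≰a)) ⟩
  subMod m a (a + m ∸ b)    ≡⟨ subMod-> m a<a+m∸b ⟩
  a + m ∸ (a + m ∸ b)       ≡⟨ m∸[m∸n]≡n (≤-trans (<⇒≤ b<m) (m≤n+m m a)) ⟩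
  b                         ∎
  where
  open ≡-Reasoning
  a<a+m∸b : a < a + m ∸ b
  a<a+m∸b = subst (a <_) (sym (+-∸-assoc a (<⇒≤ b<m)))
    (subst (_< a + (m ∸ b)) (+-identityʳ a) (+-monoʳ-< a (m<n⇒0<n∸m b<m)))

subMod≡0⇒≡ : ∀ m {a b} → b < m → subMod m a b ≡ 0 → a ≡ b
subMod≡0⇒≡ m {a} {b} b<m a-b≡0 with b ≤? a
... | yes b≤a = ≤-antisym (m∸n≡0⇒m≤n (trans (sym (subMod-≤ m b≤a)) a-b≡0)) b≤a
... | no  b≰a = ⊥-elim (<⇒≱ b<m
  (≤-trans (m≤n+m m a) (m∸n≡0⇒m≤n (trans (sym (subMod-> m (≰⇒> b≰a))) a-b≡0))))

module _ {m p : ℕ} where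

  Pair : Set
  Pair = Elt m p × Elt m p

  diffH diffG : Pair → ℕ
  diffH (r₁ , r₂) = proj₁ (quot r₁ r₂)
  diffG (r₁ , r₂) = proj₂ (quot r₁ r₂)

  isDiagonal : Pair → Bool
  isDiagonal (r₁ , r₂) = eltEq r₁ r₂

  pairs : List (Elt m p) → List Pair
  pairs R = cartesianProduct R R

  eltEq-refl : ∀ r → T (eltEq {m} {p} r r)
  eltEq-refl (a , b) = Equivalence.from T-∧ (≡⇒≡ᵇ (toℕ a) (toℕ a) refl , ≡⇒≡ᵇ (toℕ b) (toℕ b) refl)

  eltEq-sound : ∀ r s → T (eltEq {m} {p} r s) → r ≡ s
  eltEq-sound (a , b) (a′ , b′) t with Equivalence.to T-∧ t
  ... | ta , tb = cong₂ _,_ (toℕ-injective (≡ᵇ⇒≡ _ _ ta)) (toℕ-injective (≡ᵇ⇒≡ _ _ tb))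

  diffH<m : ∀ x → diffH x < m
  diffH<m ((a₁ , _) , (a₂ , _)) = subMod-< m (toℕ<n a₁) (toℕ<n a₂)

  diffG-diagonal : ∀ x → isDiagonal x ≡ true → diffG x ≡ 0
  diffG-diagonal (r₁ , r₂) e with eltEq-sound r₁ r₂ (Equivalence.from T-≡ e)
  ... | refl = subMod-self p (toℕ (proj₂ r₁))

  diff≡0⇒diagonal : ∀ x → diffH x ≡ 0 → diffG x ≡ 0 → isDiagonal x ≡ true
  diff≡0⇒diagonal ((a₁ , b₁) , (a₂ , b₂)) h≡0 g≡0
    rewrite toℕ-injective {i = a₁} {a₂} (subMod≡0⇒≡ m (toℕ<n a₂) h≡0)
          | toℕ-injective {i = b₁} {b₂} (subMod≡0⇒≡ p (toℕ<n b₂) g≡0)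
    = Equivalence.to T-≡ (eltEq-refl (a₂ , b₂))

  countB-diagonal : ∀ R → Unique R → countB isDiagonal (pairs R) ≡ length R
  countB-diagonal R uniq = begin
    countB isDiagonal (pairs R)                                           ≡⟨ countB≡sum-iverson isDiagonal (pairs R) ⟩
    sum (map (iverson ∘ isDiagonal) (pairs R))                            ≡⟨ sum-map-cartesianProduct _ R R ⟩
    sum (map (λ r → sum (map (λ s → iverson (eltEq r s)) R)) R)           ≡⟨ sum-map-cong-∈ R row ⟩
    sum (map (const 1) R)                                                 ≡⟨ sum-map-1 R ⟩
    length R                                                              ∎
    where
    open ≡-Reasoning
    row : ∀ r → r ∈ R → sum (map (λ s → iverson (eltEq r s)) R) ≡ 1
    row r r∈R = trans (sum-map-cong (λ s → sym (*-identityʳ (iverson (eltEq r s)))) R)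
                      (sum-sift eltEq eltEq-refl eltEq-sound (const 1) uniq r∈R)

  diagonal-diffG : ∀ x b → (isDiagonal x ∧ (diffG x ≡ᵇ b)) ≡ (isDiagonal x ∧ (0 ≡ᵇ b))
  diagonal-diffG x b with isDiagonal x in e
  ... | false = refl
  ... | true  = cong (_≡ᵇ b) (diffG-diagonal x e)

  convolution≡countB-diffG : ∀ R {i} → i < p →
    sumTo p (λ j → sCount R j * sCount R (subMod p j i)) ≡ countB (λ x → diffG x ≡ᵇ i) (pairs R)
  convolution≡countB-diffG R {i} i<p = begin
    sumTo p (λ j → sCount R j * sCount R (subMod p j i))
      ≡⟨ sum-map-cong (λ j → trans (cong₂ _*_ (countB≡sum-iverson _ R) (countB≡sum-iverson _ R))
                                   (sum-*-sum _ _ R R)) (upTo p) ⟩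
    sum (map (λ j → sum (map (term j) (pairs R))) (upTo p))
      ≡⟨ sum-map-comm term (upTo p) (pairs R) ⟩
    sum (map (λ x → sum (map (λ j → term j x) (upTo p))) (pairs R))
      ≡⟨ sum-map-cong sift (pairs R) ⟩
    sum (map (λ x → iverson (diffG x ≡ᵇ i)) (pairs R))
      ≡⟨ countB≡sum-iverson _ (pairs R) ⟨
    countB (λ x → diffG x ≡ᵇ i) (pairs R) ∎
    where
    open ≡-Reasoning
    g : Elt m p → ℕ
    g r = toℕ (proj₂ r)
    term : ℕ → Pair → ℕ
    term j (r₁ , r₂) = iverson (g r₁ ≡ᵇ j) * iverson (g r₂ ≡ᵇ subMod p j i)
    sift : ∀ x → sum (map (λ j → term j x) (upTo p)) ≡ iverson (diffG x ≡ᵇ i)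
    sift (r₁ , r₂) =
      trans (sum-sift-ℕ (λ j → iverson (g r₂ ≡ᵇ subMod p j i)) (toℕ<n (proj₂ r₁)))
            (cong iverson (≡ᵇ-cong
              (λ e → trans (cong (subMod p (g r₁)) e) (subMod-subMod p i<p))
              (λ e → trans (sym (subMod-subMod p (toℕ<n (proj₂ r₂)))) (cong (subMod p (g r₁)) e))))

  sumTo-reps≡countB-offDiagonal : ∀ R b →
    sumTo m (λ a → reps R a b) ≡ countB (λ x → not (isDiagonal x) ∧ (diffG x ≡ᵇ b)) (pairs R)
  sumTo-reps≡countB-offDiagonal R b =
    trans (sum-map-cong (λ a → countB-cong (λ x → ∧-left-comm (not (isDiagonal x)) (diffH x ≡ᵇ a) _) (pairs R)) (upTo m))
          (sumTo-countB-fibres m diffH _ (pairs R) diffH<m)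
    where
    ∧-left-comm : ∀ u v w → (u ∧ (v ∧ w)) ≡ (v ∧ (u ∧ w))
    ∧-left-comm u v w = trans (sym (∧-assoc u v w)) (trans (cong (_∧ w) (∧-comm u v)) (∧-assoc v u w))

  countB-diffG : ∀ R b → countB (λ x → diffG x ≡ᵇ b) (pairs R)
    ≡ countB (λ x → isDiagonal x ∧ (0 ≡ᵇ b)) (pairs R) + sumTo m (λ a → reps R a b)
  countB-diffG R b = begin
    countB (λ x → diffG x ≡ᵇ b) (pairs R)
      ≡⟨ countB-split isDiagonal _ (pairs R) ⟩
    countB (λ x → isDiagonal x ∧ (diffG x ≡ᵇ b)) (pairs R) + countB (λ x → not (isDiagonal x) ∧ (diffG x ≡ᵇ b)) (pairs R)
      ≡⟨ cong₂ _+_ (countB-cong (λ x → diagonal-diffG x b) (pairs R)) (sym (sumTo-reps≡countB-offDiagonal R b)) ⟩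
    countB (λ x → isDiagonal x ∧ (0 ≡ᵇ b)) (pairs R) + sumTo m (λ a → reps R a b) ∎
    where open ≡-Reasoning

  reps-identity : ∀ R → reps R 0 0 ≡ 0
  reps-identity R = countB-false offDiagonal-identity (pairs R)
    where
    offDiagonal-identity : ∀ x → (not (isDiagonal x) ∧ (diffH x ≡ᵇ 0) ∧ (diffG x ≡ᵇ 0)) ≡ false
    offDiagonal-identity x with diffH x ≡ᵇ 0 in eh | diffG x ≡ᵇ 0 in eg
    ... | false | _     = ∧-zeroʳ _
    ... | true  | false = ∧-zeroʳ _
    ... | true  | true
      rewrite diff≡0⇒diagonal x (≡ᵇ⇒≡ _ 0 (subst T (sym eh) _)) (≡ᵇ⇒≡ _ 0 (subst T (sym eg) _)) = refl

  -- subMod p j 0 reduces to j, so this is the case i = 0 of the convolution.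
  autocorrelation-0 : ∀ R → Unique R → 0 < p →
    sumTo p (λ j → sCount R j * sCount R j) ≡ length R + sumTo m (λ a → reps R a 0)
  autocorrelation-0 R uniq 0<p = begin
    sumTo p (λ j → sCount R j * sCount R j)
      ≡⟨ convolution≡countB-diffG R 0<p ⟩
    countB (λ x → diffG x ≡ᵇ 0) (pairs R)
      ≡⟨ countB-diffG R 0 ⟩
    countB (λ x → isDiagonal x ∧ true) (pairs R) + offDiagonal
      ≡⟨ cong (_+ offDiagonal) (countB-cong (λ x → ∧-identityʳ (isDiagonal x)) (pairs R)) ⟩
    countB isDiagonal (pairs R) + offDiagonal
      ≡⟨ cong (_+ offDiagonal) (countB-diagonal R uniq) ⟩
    length R + offDiagonal ∎
    where
    open ≡-Reasoning
    offDiagonal : ℕ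
    offDiagonal = sumTo m (λ a → reps R a 0)

  autocorrelation-suc : ∀ R {i} → suc i < p →
    sumTo p (λ j → sCount R j * sCount R (subMod p j (suc i))) ≡ sumTo m (λ a → reps R a (suc i))
  autocorrelation-suc R {i} i<p = begin
    sumTo p (λ j → sCount R j * sCount R (subMod p j (suc i)))
      ≡⟨ convolution≡countB-diffG R i<p ⟩
    countB (λ x → diffG x ≡ᵇ suc i) (pairs R)
      ≡⟨ countB-diffG R (suc i) ⟩
    countB (λ x → isDiagonal x ∧ false) (pairs R) + offDiagonal
      ≡⟨ cong (_+ offDiagonal) (countB-false (λ x → ∧-zeroʳ (isDiagonal x)) (pairs R)) ⟩
    offDiagonal ∎
    where
    open ≡-Reasoning
    offDiagonal : ℕ
    offDiagonal = sumTo m (λ a → reps R a (suc i))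

square-count : ∀ k l₁ l₃ → suc k + (0 + (l₃ + (k * l₁ + l₃))) ≡ l₁ * k + 2 * l₃ + suc k
square-count = solve-∀

shifted-count : ∀ k m₁ m₂ → 0 + (m₂ + (k * m₁ + m₂)) ≡ m₁ * k + 2 * m₂
shifted-count = solve-∀

proposition4p2 :
    (p n : ℕ) → Prime p → 2 ≤ n → (γ₁ γ₂ : ℤ) →
    -- λ₁ = (n-γ₂-2)/p + γ₂, λ₃ = (n-γ₁-1)/p + γ₁, μ₁ = (n-γ₂-2)/p, μ₂ = (n-γ₁-1)/p
    (λ₁ λ₃ μ₁ μ₂ : ℕ) →
    (+ μ₁) *ℤ (+ p) ≡ (+ n) -ℤ γ₂ -ℤ (+ 2) →
    (+ μ₂) *ℤ (+ p) ≡ (+ n) -ℤ γ₁ -ℤ (+ 1) →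
    + λ₁ ≡ (+ μ₁) +ℤ γ₂ →
    + λ₃ ≡ (+ μ₂) +ℤ γ₁ →
    (R : List (Elt (suc (suc n)) p)) →
    IsPDPDS n p R n λ₁ 0 λ₃ μ₁ μ₂ →
    (sumTo p (λ j → sCount R j * sCount R j) ≡ λ₁ * (n ∸ 1) + 2 * λ₃ + n)
    × ((i : ℕ) → 1 ≤ i → i ≤ ⌈ p ∸ 1 /2⌉ →
       sumTo p (λ j → sCount R j * sCount R (subMod p j i)) ≡ μ₁ * (n ∸ 1) + 2 * μ₂)
proposition4p2 zero    _       p-prime = ⊥-elim (¬prime[0] p-prime)
proposition4p2 (suc _) zero    _       ()
proposition4p2 (suc p′) (suc k) _ _ _ _ λ₁ λ₃ μ₁ μ₂ _ _ _ _ R pdpds = square-sum , shifted-sum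
  where
  open IsPDPDS pdpds
  open ≡-Reasoning
  square-sum : sumTo (suc p′) (λ j → sCount R j * sCount R j) ≡ λ₁ * k + 2 * λ₃ + suc k
  square-sum = begin
    sumTo (suc p′) (λ j → sCount R j * sCount R j)                       ≡⟨ autocorrelation-0 R unique (s≤s z≤n) ⟩
    length R + sumTo (3 + k) (λ a → reps R a 0)                           ≡⟨ cong₂ _+_ size (sumTo-constant-interior _ k λ₁ repλ₁) ⟩
    suc k + (reps R 0 0 + (reps R 1 0 + (k * λ₁ + reps R (2 + k) 0)))     ≡⟨ cong₂ (λ e f → suc k + (e + f)) (reps-identity R)
                                                                                 (cong₂ (λ u v → u + (k * λ₁ + v)) repλ₃₁ repλ₃₂) ⟩
    suc k + (0 + (λ₃ + (k * λ₁ + λ₃)))                                   ≡⟨ square-count k λ₁ λ₃ ⟩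
    λ₁ * k + 2 * λ₃ + suc k                                              ∎
  shifted-sum : (i : ℕ) → 1 ≤ i → i ≤ ⌈ p′ /2⌉ →
    sumTo (suc p′) (λ j → sCount R j * sCount R (subMod (suc p′) j i)) ≡ μ₁ * k + 2 * μ₂
  shifted-sum (suc i) 1≤i i≤ = begin
    sumTo (suc p′) (λ j → sCount R j * sCount R (subMod (suc p′) j (suc i)))  ≡⟨ autocorrelation-suc R (s≤s i≤p′) ⟩
    sumTo (3 + k) (λ a → reps R a (suc i))                                     ≡⟨ sumTo-constant-interior _ k μ₁ (λ a 2≤a a≤n → repμ₁ a (suc i) 2≤a a≤n 1≤i i≤p′) ⟩
    reps R 0 (suc i) + (reps R 1 (suc i) + (k * μ₁ + reps R (2 + k) (suc i)))  ≡⟨ cong₂ _+_ (repλ₂ (suc i) 1≤i i≤p′)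
                                                                                   (cong₂ (λ u v → u + (k * μ₁ + v)) (repμ₂₁ (suc i) 1≤i i≤p′) (repμ₂₂ (suc i) 1≤i i≤p′)) ⟩
    0 + (μ₂ + (k * μ₁ + μ₂))                                                   ≡⟨ shifted-count k μ₁ μ₂ ⟩
    μ₁ * k + 2 * μ₂                                                            ∎
    where
    i≤p′ : suc i ≤ p′
    i≤p′ = ≤-trans i≤ (⌈n/2⌉≤n p′)
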